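{- Every locally-transitive tournament has a unique minimal $\tau$-retentive set (i.e., Schwartz's Conjecture holds in all locally-transitive tournaments).
   Context: A tournament $T$ consists of a finite nonempty vertex set $V(T)$ and an asymmetric, complete binary relation $\succ$ on $V(T)$ ($x$ dominates $y$ if $x\succ y$). For $v\in V(T)$ let $N^-_T(v)=\{u: u\succ v\}$ and $N^+_T(v)=\{u: v\succ u\}$; for $B\subseteq V(T)$, $T[B]$ is the induced subtournament. A tournament is transitive if its relation is transitive. $T$ is locally-transitive if for every vertex $v$ both $T[N^+_T(v)]$ and $T[N^-_T(v)]$ are transitive. The tournament equilibrium set $\tau$ is defined recursively: a nonempty $A\subseteq V(T)$ is $\tau$-retentive if for every $v\in A$ with $N^-_T(v)\neq\emptyset$, $\tau(T[N^-_T(v)])\subseteq A$; $A$ is a minimal $\tau$-retentive set if no $\tau$-retentive set of $T$ is a proper subset of $A$; $\tau(T)$ is the union of all minimal $\tau$-retentive sets of $T$. -}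

module Defs where

open import Data.Nat using (ℕ; zero; suc)
open import Data.Bool using (Bool; true; false; _∧_)
open import Data.Fin using (Fin)
open import Data.Fin.Subset using (Subset; _∈_; _∉_; _⊆_; _⊂_; ⊤; Nonempty)
open import Data.Vec using (tabulate)
open import Data.Product using (Σ; _×_; ∃)
open import Data.Sum using (_⊎_)
open import Data.Empty using (⊥)
open import Relation.Nullary using (¬_; Dec; does)
open import Relation.Binary.PropositionalEquality using (_≡_; _≢_)

record Tournament (n : ℕ) : Set₁ where
  field
    _≻_      : Fin n → Fin n → Set
    _≻?_     : (x y : Fin n) → Dec (x ≻ y)
    asym     : ∀ {x y} → x ≻ y → ¬ (y ≻ x)
    complete : ∀ {x y} → x ≢ y → (x ≻ y) ⊎ (y ≻ x)

module _ {n : ℕ} (T : Tournament n) where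
  open Tournament T

  -- Vertex set B of the subtournament T[B] is a Subset n; T[B] has the
  -- restricted relation.  In-neighbourhood of v in T[B]: {u ∈ B : u ≻ v}.
  N⁻ : Subset n → Fin n → Subset n
  N⁻ B v = tabulate (λ u → Data.Vec.lookup B u ∧ does (u ≻? v))

  N⁺ : Fin n → Subset n
  N⁺ v = tabulate (λ u → does (v ≻? u))

  TransitiveOn : Subset n → Set
  TransitiveOn B = ∀ x y z → x ∈ B → y ∈ B → z ∈ B → x ≻ y → y ≻ z → x ≻ z

  LocallyTransitive : Set
  LocallyTransitive = ∀ v → TransitiveOn (N⁺ v) × TransitiveOn (N⁻ ⊤ v)

  -- Tournament equilibrium set, defined by recursion on a fuel parameter
  -- k (always ≥ the size of the vertex set involved).
  -- τ-fuel k B x   : x ∈ τ(T[B])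
  -- Retentive k B A : A is a τ-retentive set of T[B]
  τ-fuel    : ℕ → Subset n → Fin n → Set
  Retentive : ℕ → Subset n → Subset n → Set

  Retentive k B A =
    Nonempty A × A ⊆ B ×
    (∀ v → v ∈ A → Nonempty (N⁻ B v) → ∀ y → τ-fuel k (N⁻ B v) y → y ∈ A)

  τ-fuel zero    B x = ⊥
  τ-fuel (suc k) B x =
    Σ (Subset n) λ A →
      (Retentive k B A × (∀ A' → Retentive k B A' → ¬ (A' ⊂ A))) × x ∈ A

  IsτRetentive : Subset n → Subset n → Set
  IsτRetentive B A = Retentive n B A

  IsMinimalτRetentive : Subset n → Subset n → Set
  IsMinimalτRetentive B A =
    IsτRetentive B A × (∀ A' → IsτRetentive B A' → ¬ (A' ⊂ A))

  τ : Subset n → Fin n → Set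
  τ B x = τ-fuel (suc n) B x

-- When every in-neighbourhood N⁻(v) is transitive it has a Condorcet winner w(v), and τ of a
-- tournament with a Condorcet winner is that winner alone.  Hence τ-retentive sets are exactly
-- the nonempty sets closed under w.  Two nonempty w-closed sets always meet: if A and B were
-- disjoint with a ≻ b, take the lowest t of A ∩ N⁻(b); following w from b, t and w(t) leads
-- to w(w(t)) ∈ A ∩ N⁻(b) beating t, and then w(t) would have to beat its own winner.  Since
-- intersections of w-closed sets are w-closed, a minimal nonempty w-closed set lies inside
-- every other one, so it is the unique minimal τ-retentive set.
module Submission where

open import Defs
open import Data.Nat using (ℕ; zero; suc; _≤_; _<_)
open import Data.Nat.Properties using (≤-trans; <-≤-trans; ≤-pred)
open import Data.Nat.Induction using (<-wellFounded)
open import Induction.WellFounded using (Acc; acc)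
open import Data.Bool using (true; _∧_)
open import Data.Bool.Properties using (∧-conicalˡ; ∧-conicalʳ)
open import Data.Fin using (Fin; _≟_)
open import Data.Fin.Properties using (all?)
open import Data.Fin.Subset using (Subset; ⊤; _∈_; _⊆_; _⊂_; Nonempty; Empty; ⁅_⁆; ∣_∣; _∩_)
open import Data.Fin.Subset.Properties
  using (_∈?_; _⊂?_; ∈⊤; ⊆⊤; x∈⁅x⁆; x∈⁅y⁆⇒x≡y; p⊂q⇒∣p∣<∣q∣; x∈p⇒∣p-x∣<∣p∣; ∣p∣≤n;
         ⊆-antisym; anySubset?; nonempty?; x∈p∩q⁺; x∈p∩q⁻; p∩q⊆p; p∩q⊆q; ∩-comm; ⊂-irref; ⊆-⊂-trans)
open import Data.List using (List; []; _∷_; allFin; filter)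
open import Data.List.Relation.Unary.Any using (here; there)
open import Data.List.Membership.Propositional using () renaming (_∈_ to _∈ₗ_)
open import Data.List.Membership.Propositional.Properties using (∈-allFin; ∈-filter⁺; ∈-filter⁻)
open import Data.Vec using (lookup)
open import Data.Vec.Properties using (lookup∘tabulate; []=⇒lookup; lookup⇒[]=)
open import Data.Product using (Σ; _×_; _,_; proj₁; proj₂)
open import Data.Sum using (_⊎_; inj₁; inj₂; swap)
open import Function using (flip; _∘_)
open import Level using (Level)
open import Relation.Binary.Core using (Rel)
open import Relation.Binary.Definitions using (DecidableEquality)
open import Relation.Nullary using (¬_; Dec; yes; no; does; contradiction)
open import Relation.Nullary.Decidable using (_×-dec_; _→-dec_; ¬?; dec-true)
open import Relation.Unary using (Pred; Decidable)
open import Relation.Binary.PropositionalEquality using (_≡_; _≢_; refl; sym; trans; subst; cong₂)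

private
  variable
    a r ℓ : Level
    n : ℕ

module _ {A : Set a} (_≟ₐ_ : DecidableEquality A) (R : Rel A r)
         (total : ∀ {x y} → x ≢ y → R x y ⊎ R y x) where

  greatestₗ : ∀ (xs : List A) {x} → x ∈ₗ xs →
              (∀ {x y z} → x ∈ₗ xs → y ∈ₗ xs → z ∈ₗ xs → R x y → R y z → R x z) →
              Σ A λ t → t ∈ₗ xs × (∀ {u} → u ∈ₗ xs → u ≢ t → R t u)
  greatestₗ (x ∷ []) _ _ = x , here refl , λ { (here refl) x≢x → contradiction refl x≢x }
  greatestₗ (x ∷ y ∷ xs) _ trans-on with greatestₗ (y ∷ xs) (here refl)
                                           (λ p q s → trans-on (there p) (there q) (there s))
  ... | t , t∈ , t-greatest with x ≟ₐ t
  ...   | yes refl = t , there t∈ , λ { (here refl) t≢t → contradiction refl t≢t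
                                      ; (there u∈) → t-greatest u∈ }
  ...   | no x≢t with total x≢t
  ...     | inj₂ Rtx = t , there t∈ , λ { (here refl) _ → Rtx ; (there u∈) → t-greatest u∈ }
  ...     | inj₁ Rxt = x , here refl , λ { (here refl) x≢x → contradiction refl x≢x
                                         ; (there u∈) _ → R-from-x u∈ }
    where
    R-from-x : ∀ {u} → u ∈ₗ y ∷ xs → R x u
    R-from-x {u} u∈ with u ≟ₐ t
    ... | yes refl = Rxt
    ... | no u≢t = trans-on (here refl) (there t∈) (there u∈) Rxt (t-greatest u∈ u≢t)

module _ (R : Rel (Fin n) r) where

  IsGreatest : Subset n → Fin n → Set r
  IsGreatest S t = t ∈ S × (∀ u → u ∈ S → u ≢ t → R t u)

  greatest : (∀ {x y} → x ≢ y → R x y ⊎ R y x) → ∀ S →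
             (∀ x y z → x ∈ S → y ∈ S → z ∈ S → R x y → R y z → R x z) →
             Nonempty S → Σ (Fin n) (IsGreatest S)
  greatest total S trans-on (x , x∈S) =
    let t , t∈ , t-greatest = greatestₗ _≟_ R total elems (∈ₑ x∈S) trans-elems
    in t , ∈ₛ t∈ , λ u u∈S u≢t → t-greatest (∈ₑ u∈S) u≢t
    where
    elems : List (Fin n)
    elems = filter (_∈? S) (allFin n)
    ∈ₑ : ∀ {x} → x ∈ S → x ∈ₗ elems
    ∈ₑ x∈S = ∈-filter⁺ (_∈? S) (∈-allFin _) x∈S
    ∈ₛ : ∀ {x} → x ∈ₗ elems → x ∈ S
    ∈ₛ x∈ = proj₂ (∈-filter⁻ (_∈? S) {xs = allFin n} x∈)
    trans-elems : ∀ {x y z} → x ∈ₗ elems → y ∈ₗ elems → z ∈ₗ elems → R x y → R y z → R x z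
    trans-elems p q s = trans-on _ _ _ (∈ₛ p) (∈ₛ q) (∈ₛ s)

does≡true⇒ : ∀ {P : Set} (P? : Dec P) → does P? ≡ true → P
does≡true⇒ (yes p) _ = p
does≡true⇒ (no _) ()

⁅x⁆⊂p : ∀ {x y} {p : Subset n} → x ∈ p → y ∈ p → y ≢ x → ⁅ x ⁆ ⊂ p
⁅x⁆⊂p {x = x} {p = p} x∈p y∈p y≢x =
  (λ z∈⁅x⁆ → subst (_∈ p) (sym (x∈⁅y⁆⇒x≡y x z∈⁅x⁆)) x∈p) ,
  _ , y∈p , λ y∈⁅x⁆ → y≢x (x∈⁅y⁆⇒x≡y x y∈⁅x⁆)

x∈p⇒p⊄⁅x⁆ : ∀ {x} {p : Subset n} → x ∈ p → ¬ (p ⊂ ⁅ x ⁆)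
x∈p⇒p⊄⁅x⁆ {x = x} {p} x∈p (_ , y , y∈⁅x⁆ , y∉p) = y∉p (subst (_∈ p) (sym (x∈⁅y⁆⇒x≡y x y∈⁅x⁆)) x∈p)

p⊆q∧p⊄q⇒q⊆p : ∀ {p q : Subset n} → p ⊆ q → ¬ (p ⊂ q) → q ⊆ p
p⊆q∧p⊄q⇒q⊆p {p = p} p⊆q p⊄q {x} x∈q with x ∈? p
... | yes x∈p = x∈p
... | no x∉p = contradiction ((λ {y} → p⊆q {y}) , x , x∈q , x∉p) p⊄q

⊂-minimal : ∀ {P : Pred (Subset n) ℓ} → Decidable P → ∀ {A} → P A →
            Σ (Subset n) λ M → P M × (∀ B → P B → ¬ (B ⊂ M))
⊂-minimal {P = P} P? {A} = go A (<-wellFounded ∣ A ∣)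
  where
  go : ∀ A → Acc _<_ ∣ A ∣ → P A → Σ (Subset _) λ M → P M × (∀ B → P B → ¬ (B ⊂ M))
  go A (acc smaller) PA with anySubset? (λ B → P? B ×-dec (B ⊂? A))
  ... | yes (B , PB , B⊂A) = go B (smaller (p⊂q⇒∣p∣<∣q∣ B⊂A)) PB
  ... | no ∄B = A , PA , λ B PB B⊂A → ∄B (B , PB , B⊂A)

module _ (T : Tournament n) where
  open Tournament T

  IsWinner : Subset n → Fin n → Set
  IsWinner = IsGreatest _≻_

  ≻⇒≢ : ∀ {x y} → x ≻ y → x ≢ y
  ≻⇒≢ x≻y refl = asym x≻y x≻y

  ⊁⇒≻ : ∀ {x y} → x ≢ y → ¬ (y ≻ x) → x ≻ y
  ⊁⇒≻ x≢y y⊁x with complete x≢y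
  ... | inj₁ x≻y = x≻y
  ... | inj₂ y≻x = contradiction y≻x y⊁x

  x∈N⁻⁺ : ∀ {B u v} → u ∈ B → u ≻ v → u ∈ N⁻ T B v
  x∈N⁻⁺ {B} {u} {v} u∈B u≻v =
    lookup⇒[]= u _ (trans (lookup∘tabulate _ u) (cong₂ _∧_ ([]=⇒lookup u∈B) (dec-true (u ≻? v) u≻v)))

  x∈N⁻⁻ : ∀ B v {u} → u ∈ N⁻ T B v → u ∈ B × u ≻ v
  x∈N⁻⁻ B v {u} u∈N =
    lookup⇒[]= u B (∧-conicalˡ _ _ both) ,
    does≡true⇒ (u ≻? v) (∧-conicalʳ (lookup B u) _ both)
    where
    both : lookup B u ∧ does (u ≻? v) ≡ true
    both = trans (sym (lookup∘tabulate _ u)) ([]=⇒lookup u∈N)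

  ∣N⁻∣<∣B∣ : ∀ {B v} → v ∈ B → ∣ N⁻ T B v ∣ < ∣ B ∣
  ∣N⁻∣<∣B∣ {B} {v} v∈B = p⊂q⇒∣p∣<∣q∣
    ((λ u∈N → proj₁ (x∈N⁻⁻ B v u∈N)) , v , v∈B ,
     λ v∈N → ≻⇒≢ (proj₂ (x∈N⁻⁻ B v v∈N)) refl)

  winner-N⁻ : ∀ {B t v} → IsWinner B t → v ∈ B → v ≢ t → IsWinner (N⁻ T B v) t
  winner-N⁻ {v = v} (t∈B , t-wins) v∈B v≢t =
    x∈N⁻⁺ t∈B (t-wins _ v∈B v≢t) , λ u u∈N u≢t → t-wins u (proj₁ (x∈N⁻⁻ _ v u∈N)) u≢t

  N⁻-winner-empty : ∀ {B t} → IsWinner B t → Empty (N⁻ T B t)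
  N⁻-winner-empty {B} {t} (_ , t-wins) (u , u∈N) =
    let u∈B , u≻t = x∈N⁻⁻ B t u∈N in asym u≻t (t-wins u u∈B (≻⇒≢ u≻t))

  ⁅winner⁆-retentive : ∀ {k B t} → IsWinner B t → Retentive T k B ⁅ t ⁆
  ⁅winner⁆-retentive {B = B} {t} w@(t∈B , _) =
    (t , x∈⁅x⁆ t) ,
    (λ u∈⁅t⁆ → subst (_∈ B) (sym (x∈⁅y⁆⇒x≡y t u∈⁅t⁆)) t∈B) ,
    λ v v∈⁅t⁆ N⁻v≠∅ → contradiction (subst (λ v → Nonempty (N⁻ T B v)) (x∈⁅y⁆⇒x≡y t v∈⁅t⁆) N⁻v≠∅)
                                    (N⁻-winner-empty w)

  mutual
    winner∈retentive : ∀ {k B t A} → IsWinner B t → ∣ B ∣ ≤ suc k → Retentive T k B A → t ∈ A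
    winner∈retentive {B = B} {t} w ∣B∣≤ ((a , a∈A) , A⊆B , closed) with a ≟ t
    ... | yes refl = a∈A
    ... | no a≢t = closed a a∈A (t , proj₁ w′) t
                     (winner∈τ-fuel w′ (≤-pred (<-≤-trans (∣N⁻∣<∣B∣ (A⊆B a∈A)) ∣B∣≤)))
      where
      w′ : IsWinner (N⁻ T B a) t
      w′ = winner-N⁻ w (A⊆B a∈A) a≢t

    winner∈τ-fuel : ∀ {k B t} → IsWinner B t → ∣ B ∣ ≤ k → τ-fuel T k B t
    winner∈τ-fuel {zero} (t∈B , _) ∣B∣≤0 with ≤-trans (x∈p⇒∣p-x∣<∣p∣ t∈B) ∣B∣≤0
    ... | ()
    winner∈τ-fuel {suc k} {t = t} w ∣B∣≤ =
      ⁅ t ⁆ ,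
      (⁅winner⁆-retentive w , λ A A-ret → x∈p⇒p⊄⁅x⁆ (winner∈retentive w ∣B∣≤ A-ret)) ,
      x∈⁅x⁆ t

  τ-fuel⇒winner : ∀ {k B t x} → IsWinner B t → ∣ B ∣ ≤ k → τ-fuel T k B x → x ≡ t
  τ-fuel⇒winner {suc k} {t = t} {x} w ∣B∣≤ (A , (A-ret , A-minimal) , x∈A) with x ≟ t
  ... | yes x≡t = x≡t
  ... | no x≢t = contradiction (⁅x⁆⊂p (winner∈retentive w ∣B∣≤ A-ret) x∈A x≢t)
                               (A-minimal ⁅ t ⁆ (⁅winner⁆-retentive w))

  WinnerClosed : Subset n → Set
  WinnerClosed A = ∀ v t → v ∈ A → IsWinner (N⁻ T ⊤ v) t → t ∈ A

  isWinner? : ∀ B t → Dec (IsWinner B t)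
  isWinner? B t = (t ∈? B) ×-dec all? λ u → (u ∈? B) →-dec (¬? (u ≟ t) →-dec (t ≻? u))

  winnerClosed? : ∀ A → Dec (WinnerClosed A)
  winnerClosed? A = all? λ v → all? λ t → (v ∈? A) →-dec (isWinner? (N⁻ T ⊤ v) t →-dec (t ∈? A))

  ∩-winnerClosed : ∀ {A B} → WinnerClosed A → WinnerClosed B → WinnerClosed (A ∩ B)
  ∩-winnerClosed {A} {B} A-closed B-closed v t v∈A∩B w =
    let v∈A , v∈B = x∈p∩q⁻ A B v∈A∩B in x∈p∩q⁺ (A-closed v t v∈A w , B-closed v t v∈B w)

  τRetentive⇒winnerClosed : ∀ {A} → IsτRetentive T ⊤ A → WinnerClosed A
  τRetentive⇒winnerClosed (_ , _ , closed) v t v∈A w =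
    closed v v∈A (t , proj₁ w) t (winner∈τ-fuel w (∣p∣≤n (N⁻ T ⊤ v)))

module _ (T : Tournament n) (in-transitive : ∀ v → TransitiveOn T (N⁻ T ⊤ v)) where
  open Tournament T

  winner : ∀ v → Nonempty (N⁻ T ⊤ v) → Σ (Fin n) (IsWinner T (N⁻ T ⊤ v))
  winner v = greatest _≻_ complete (N⁻ T ⊤ v) (in-transitive v)

  winnerClosed⇒τRetentive : ∀ {A} → Nonempty A → WinnerClosed T A → IsτRetentive T ⊤ A
  winnerClosed⇒τRetentive {A} A≠∅ A-closed = A≠∅ , ⊆⊤ , λ v v∈A N⁻v≠∅ y y∈τ →
    let t , w = winner v N⁻v≠∅
    in subst (_∈ A) (sym (τ-fuel⇒winner T w (∣p∣≤n (N⁻ T ⊤ v)) y∈τ)) (A-closed v t v∈A w)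

  winner-of : ∀ {u v} → u ≻ v → Fin n
  winner-of {u} {v} u≻v = proj₁ (winner v (u , x∈N⁻⁺ T ∈⊤ u≻v))

  winner-of-wins : ∀ {u v} (u≻v : u ≻ v) → IsWinner T (N⁻ T ⊤ v) (winner-of u≻v)
  winner-of-wins {u} {v} u≻v = proj₂ (winner v (u , x∈N⁻⁺ T ∈⊤ u≻v))

  winner-of-≻ : ∀ {u v} (u≻v : u ≻ v) → winner-of u≻v ≻ v
  winner-of-≻ u≻v = proj₂ (x∈N⁻⁻ T ⊤ _ (proj₁ (winner-of-wins u≻v)))

  winner-of-beats : ∀ {u v x} (u≻v : u ≻ v) → x ≻ v → x ≢ winner-of u≻v → winner-of u≻v ≻ x
  winner-of-beats u≻v x≻v = proj₂ (winner-of-wins u≻v) _ (x∈N⁻⁺ T ∈⊤ x≻v)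

  winnerClosed-no-arc : ∀ {A B a b} → WinnerClosed T A → WinnerClosed T B → Empty (A ∩ B) →
                        a ∈ A → b ∈ B → ¬ (a ≻ b)
  winnerClosed-no-arc {A} {B} {a} {b} A-closed B-closed A∩B=∅ a∈A b∈B a≻b =
    asym w₃≻w₂ (winner-of-beats w₁≻t w₃≻t (≻⇒≢ T w₃≻w₂))
    where
    apart : ∀ {x y} → x ∈ A → y ∈ B → x ≢ y
    apart x∈A y∈B refl = A∩B=∅ (_ , x∈p∩q⁺ (x∈A , y∈B))

    L : Subset n
    L = A ∩ N⁻ T ⊤ b

    ∈L⇒≻b : ∀ {u} → u ∈ L → u ≻ b
    ∈L⇒≻b u∈L = proj₂ (x∈N⁻⁻ T ⊤ b (proj₂ (x∈p∩q⁻ A _ u∈L)))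

    lowest : Σ (Fin n) (IsGreatest (flip _≻_) L)
    lowest = greatest (flip _≻_) (swap ∘ complete) L
      (λ x y z x∈ y∈ z∈ y≻x z≻y →
         in-transitive b z y x (x∈N⁻⁺ T ∈⊤ (∈L⇒≻b z∈)) (x∈N⁻⁺ T ∈⊤ (∈L⇒≻b y∈))
                               (x∈N⁻⁺ T ∈⊤ (∈L⇒≻b x∈)) z≻y y≻x)
      (a , x∈p∩q⁺ (a∈A , x∈N⁻⁺ T ∈⊤ a≻b))

    t : Fin n
    t = proj₁ lowest
    t∈A : t ∈ A
    t∈A = proj₁ (x∈p∩q⁻ A _ (proj₁ (proj₂ lowest)))
    t≻b : t ≻ b
    t≻b = ∈L⇒≻b (proj₁ (proj₂ lowest))

    w₁ : Fin n
    w₁ = winner-of t≻b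
    w₁∈B : w₁ ∈ B
    w₁∈B = B-closed b w₁ b∈B (winner-of-wins t≻b)
    w₁≻t : w₁ ≻ t
    w₁≻t = winner-of-beats t≻b t≻b (apart t∈A w₁∈B)

    w₂ : Fin n
    w₂ = winner-of w₁≻t
    w₂∈A : w₂ ∈ A
    w₂∈A = A-closed t w₂ t∈A (winner-of-wins w₁≻t)
    w₂≻w₁ : w₂ ≻ w₁
    w₂≻w₁ = winner-of-beats w₁≻t w₁≻t (apart w₂∈A w₁∈B ∘ sym)
    b≻w₂ : b ≻ w₂
    b≻w₂ = ⊁⇒≻ T (apart w₂∈A b∈B ∘ sym)
             (λ w₂≻b → asym w₂≻w₁ (winner-of-beats t≻b w₂≻b (apart w₂∈A w₁∈B)))

    w₃ : Fin n
    w₃ = winner-of b≻w₂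
    w₃∈A : w₃ ∈ A
    w₃∈A = A-closed w₂ w₃ w₂∈A (winner-of-wins b≻w₂)
    w₃≻w₂ : w₃ ≻ w₂
    w₃≻w₂ = winner-of-≻ b≻w₂
    w₃≻b : w₃ ≻ b
    w₃≻b = winner-of-beats b≻w₂ b≻w₂ (apart w₃∈A b∈B ∘ sym)
    w₃≻t : w₃ ≻ t
    w₃≻t = proj₂ (proj₂ lowest) w₃ (x∈p∩q⁺ (w₃∈A , x∈N⁻⁺ T ∈⊤ w₃≻b))
             (λ w₃≡t → asym (winner-of-≻ w₁≻t) (subst (_≻ w₂) w₃≡t w₃≻w₂))

  winnerClosed-meet : ∀ {A B} → Nonempty A → Nonempty B → WinnerClosed T A → WinnerClosed T B →
                      Nonempty (A ∩ B)
  winnerClosed-meet {A} {B} (a , a∈A) (b , b∈B) A-closed B-closed with nonempty? (A ∩ B)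
  ... | yes A∩B≠∅ = A∩B≠∅
  ... | no A∩B=∅ with a ≟ b
  ...   | yes refl = contradiction (a , x∈p∩q⁺ (a∈A , b∈B)) A∩B=∅
  ...   | no a≢b with complete a≢b
  ...     | inj₁ a≻b = contradiction a≻b (winnerClosed-no-arc A-closed B-closed A∩B=∅ a∈A b∈B)
  ...     | inj₂ b≻a = contradiction b≻a
                         (winnerClosed-no-arc B-closed A-closed (A∩B=∅ ∘ subst Nonempty (∩-comm B A))
                                              b∈B a∈A)

  least-winnerClosed : ∀ {A} → Nonempty A → WinnerClosed T A →
                       Σ (Subset n) λ M → (Nonempty M × WinnerClosed T M) ×
                         (∀ B → Nonempty B → WinnerClosed T B → M ⊆ B)
  least-winnerClosed A≠∅ A-closed with ⊂-minimal (λ A → nonempty? A ×-dec winnerClosed? T A)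
                                                  (A≠∅ , A-closed)
  ... | M , (M≠∅ , M-closed) , M-minimal = M , (M≠∅ , M-closed) , M⊆
    where
    M⊆ : ∀ B → Nonempty B → WinnerClosed T B → M ⊆ B
    M⊆ B B≠∅ B-closed =
      p∩q⊆q M B ∘ p⊆q∧p⊄q⇒q⊆p (p∩q⊆p M B)
        (M-minimal (M ∩ B) (winnerClosed-meet M≠∅ B≠∅ M-closed B-closed ,
                            ∩-winnerClosed T M-closed B-closed))

  unique-minimal-τRetentive : Nonempty (⊤ {n}) →
    Σ (Subset n) λ M → IsMinimalτRetentive T ⊤ M × (∀ A → IsMinimalτRetentive T ⊤ A → A ≡ M)
  unique-minimal-τRetentive ⊤≠∅ with least-winnerClosed ⊤≠∅ (λ _ _ _ _ → ∈⊤)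
  ... | M , (M≠∅ , M-closed) , M-least = M , (M-τRetentive , M-minimal) , M-unique
    where
    M-τRetentive : IsτRetentive T ⊤ M
    M-τRetentive = winnerClosed⇒τRetentive M≠∅ M-closed
    M⊆τRetentive : ∀ {A} → IsτRetentive T ⊤ A → M ⊆ A
    M⊆τRetentive A-ret = M-least _ (proj₁ A-ret) (τRetentive⇒winnerClosed T A-ret)
    M-minimal : ∀ A → IsτRetentive T ⊤ A → ¬ (A ⊂ M)
    M-minimal A A-ret A⊂M = ⊂-irref refl (⊆-⊂-trans (M⊆τRetentive A-ret) A⊂M)
    M-unique : ∀ A → IsMinimalτRetentive T ⊤ A → A ≡ M
    M-unique A (A-ret , A-minimal) =
      ⊆-antisym (p⊆q∧p⊄q⇒q⊆p (M⊆τRetentive A-ret) (A-minimal M M-τRetentive)) (M⊆τRetentive A-ret)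

theorem8 : (n : ℕ) (T : Tournament (suc n)) → LocallyTransitive T →
    Σ (Subset (suc n)) λ A →
      IsMinimalτRetentive T ⊤ A ×
      (∀ A' → IsMinimalτRetentive T ⊤ A' → A' ≡ A)
theorem8 n T locally-transitive =
  unique-minimal-τRetentive T (λ v → proj₂ (locally-transitive v)) (Fin.zero , ∈⊤)
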